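{- There is no SLCS formula $\varphi$ such that for every neighbourhood model $\mathcal{M}$, the underlying space of $\mathcal{M}$ is $T_0$-separated if and only if $\mathcal{M},x\models\varphi$ for every point $x$ of $\mathcal{M}$.
   Context: A neighbourhood space $(X,\mathcal{N})$ assigns to each $x\in X$ a filter $\mathcal{N}(x)$ on $X$ (non-empty-intersection-closed, upward closed, not containing $\emptyset$) with $x\in N$ for all $N\in\mathcal{N}(x)$. Closure: $\mathcal{C}(A)=\{x\mid\forall N\in\mathcal{N}(x): A\cap N\ne\emptyset\}$. Continuity of $f$: for all $x$ and $N_2\in\mathcal{N}_2(f(x))$, $f^{ -1}[N_2]\in\mathcal{N}_1(x)$. Sets $U,V$ are semi-separated if $\mathcal{C}(U)\cap V=U\cap\mathcal{C}(V)=\emptyset$; connected = not a union of two non-empty semi-separated sets. An index space $(I,\mathcal{N}_I,\le,0)$ is a connected neighbourhood space with a linear order with least element $0$; a path is a continuous map from the index space into the space. A neighbourhood model is $((X,\mathcal{N}),\mathcal{I},V)$ with $\mathcal{I}$ an index space and $V:X\to\mathcal{P}(\mathsf{P})$ a valuation of atoms. SLCS formulas: $\varphi::=a\mid\top\mid\neg\varphi\mid\varphi\wedge\varphi\mid\mathcal{N}\varphi\mid\varphi\,\mathcal{R}\,\varphi\mid\varphi\,\mathcal{P}\,\varphi$, with semantics: $x\models a$ iff $a\in V(x)$; Booleans as usual; $x\models\mathcal{N}\varphi$ iff $x\in\mathcal{C}(\{y\mid y\models\varphi\})$; $x\models\varphi\,\mathcal{R}\,\psi$ iff there are a path $p$ and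 $n$ with $p(n)=x$, $p(0)\models\psi$ and $p(i)\models\varphi$ for all $0<i\le n$; $x\models\varphi\,\mathcal{P}\,\psi$ iff there are a path $p$ with $p(0)=x$ and $n$ with $p(n)\models\psi$ and $p(i)\models\varphi$ for all $0\le i<n$. A space is $T_0$-separated if for all points $x,y$, $y\in\mathcal{C}(\{x\})$ and $x\in\mathcal{C}(\{y\})$ imply $x=y$. -}

module Defs where

open import Data.Product using (Σ; ∃; _×_; _,_)
open import Data.Sum using (_⊎_)
open import Data.Empty using (⊥)
open import Data.Unit using (⊤)
open import Level using (Level; Lift; lift)
open import Relation.Nullary using (¬_)
open import Relation.Binary.PropositionalEquality using (_≡_)

Subset : Set → Set₁
Subset X = X → Set

_⊆_ : {X : Set} → Subset X → Subset X → Set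
A ⊆ B = ∀ y → A y → B y

_∩_ : {X : Set} → Subset X → Subset X → Subset X
(A ∩ B) y = A y × B y

IsEmpty : {X : Set} → Subset X → Set
IsEmpty A = ∀ y → ¬ A y

record IsFilter {X : Set} (F : Subset X → Set) : Set₁ where
  field
    has-full  : F (λ _ → ⊤)
    ∩-closed  : ∀ A B → F A → F B → F (A ∩ B)
    up-closed : ∀ A B → A ⊆ B → F A → F B
    no-empty  : ∀ A → IsEmpty A → ¬ F A

record NbhdSpace : Set₁ where
  field
    Carrier : Set
    𝒩       : Carrier → Subset Carrier → Set
    filter  : ∀ x → IsFilter (𝒩 x)
    member  : ∀ x N → 𝒩 x N → N x

module _ (S : NbhdSpace) where
  open NbhdSpace S

  -- closure operator
  -- (level-polymorphic in the predicate, so it applies to satisfaction sets)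
  𝒞 : {ℓ : Level} → (Carrier → Set ℓ) → Carrier → Set (Level.suc Level.zero Level.⊔ ℓ)
  𝒞 A x = ∀ N → 𝒩 x N → ∃ λ y → A y × N y

  SemiSeparated : Subset Carrier → Subset Carrier → Set₁
  SemiSeparated U V =
    (∀ x → ¬ (𝒞 U x × V x)) × (∀ x → ¬ (U x × 𝒞 V x))

  Connected : Set₁
  Connected = ¬ (Σ (Subset Carrier) λ U → Σ (Subset Carrier) λ V →
                   (∀ x → U x ⊎ V x) × (∃ λ u → U u) × (∃ λ v → V v)
                   × SemiSeparated U V)

  T₀ : Set₁
  T₀ = ∀ x y → 𝒞 (λ z → z ≡ x) y → 𝒞 (λ z → z ≡ y) x → x ≡ y

Continuous : (S₁ S₂ : NbhdSpace) → (NbhdSpace.Carrier S₁ → NbhdSpace.Carrier S₂) → Set₁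
Continuous S₁ S₂ f =
  ∀ x (N₂ : Subset (NbhdSpace.Carrier S₂)) → NbhdSpace.𝒩 S₂ (f x) N₂ →
    NbhdSpace.𝒩 S₁ x (λ y → N₂ (f y))

record IndexSpace : Set₁ where
  field
    space     : NbhdSpace
  open NbhdSpace space public renaming (Carrier to I)
  field
    connected : Connected space
    _≤_       : I → I → Set
    ≤-refl    : ∀ i → i ≤ i
    ≤-trans   : ∀ i j k → i ≤ j → j ≤ k → i ≤ k
    ≤-antisym : ∀ i j → i ≤ j → j ≤ i → i ≡ j
    ≤-total   : ∀ i j → i ≤ j ⊎ j ≤ i
    0ᵢ        : I
    0-least   : ∀ i → 0ᵢ ≤ i

  _<_ : I → I → Set
  i < j = i ≤ j × ¬ (i ≡ j)

record NbhdModel (P : Set) : Set₁ where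
  field
    space : NbhdSpace
    index : IndexSpace
    V     : NbhdSpace.Carrier space → P → Set
  open NbhdSpace space public renaming (Carrier to X)

  Path : Set₁
  Path = Σ (IndexSpace.I index → X) λ p →
           Continuous (IndexSpace.space index) space p

data Formula (P : Set) : Set where
  atom : P → Formula P
  ⊤ᶠ   : Formula P
  ¬ᶠ_  : Formula P → Formula P
  _∧ᶠ_ : Formula P → Formula P → Formula P
  𝓝    : Formula P → Formula P
  _𝓡_  : Formula P → Formula P → Formula P
  _𝓟_  : Formula P → Formula P → Formula P

module Sem {P : Set} (M : NbhdModel P) where
  open NbhdModel M
  open IndexSpace index using (I; 0ᵢ; _≤_; _<_)

  _⊨_ : X → Formula P → Set₁
  x ⊨ atom a   = Lift _ (V x a)
  x ⊨ ⊤ᶠ       = Lift _ ⊤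
  x ⊨ (¬ᶠ φ)   = ¬ (x ⊨ φ)
  x ⊨ (φ ∧ᶠ ψ) = (x ⊨ φ) × (x ⊨ ψ)
  x ⊨ 𝓝 φ      = 𝒞 space (λ y → y ⊨ φ) x
  x ⊨ (φ 𝓡 ψ)  = Σ Path λ { (p , _) → Σ I λ n → (p n ≡ x) × (p 0ᵢ ⊨ ψ) ×
                   (∀ i → 0ᵢ < i → i ≤ n → p i ⊨ φ) }
  x ⊨ (φ 𝓟 ψ)  = Σ Path λ { (p , _) → (p 0ᵢ ≡ x) × Σ I λ n → (p n ⊨ ψ) ×
                   (∀ i → 0ᵢ ≤ i → i < n → p i ⊨ φ) }

module Submission where

-- In an indiscrete space (the only neighbourhood of a point is the whole
-- space) every map into the space is continuous, and a set's closure is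
-- everything or nothing depending only on whether the set is inhabited.
-- Consequently, in an indiscrete model whose valuation does not depend on
-- the point, the truth of a formula does not depend on the point, nor on
-- the carrier, nor on the index space: it equals a proposition ⟦ φ ⟧
-- computed from φ alone (lemma `uniform-truth`; constant paths witness the
-- reachability operators).
--
-- The one-point indiscrete space is T₀, the two-point one is not, yet both
-- models (empty valuation, one-point index space) satisfy exactly the same
-- formulas everywhere; so no formula can characterise T₀.

open import Defs
open import Data.Bool using (Bool; true; false)
open import Data.Empty using (⊥; ⊥-elim)
open import Data.Product using (Σ; ∃; _×_; _,_)
open import Data.Sum using (inj₁)
open import Data.Unit using (tt) renaming (⊤ to Unit)
open import Function.Bundles using (_⇔_; mk⇔; Equivalence)
open import Level using (Level; lift; lower)
open import Relation.Nullary using (¬_)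
open import Relation.Binary.PropositionalEquality using (_≡_; refl; subst)

-- The indiscrete neighbourhood space on an inhabited set X: the whole
-- space is the only neighbourhood.  (The point x₀ rules out ∅ as a filter member.)
indiscrete : (X : Set) → X → NbhdSpace
indiscrete X x₀ = record
  { Carrier = X
  ; 𝒩       = λ _ N → ∀ y → N y
  ; filter  = λ _ → record
      { has-full  = λ _ → tt
      ; ∩-closed  = λ _ _ a b y → a y , b y
      ; up-closed = λ _ _ A⊆B a y → A⊆B y (a y)
      ; no-empty  = λ A empty full → empty x₀ (full x₀) }
  ; member  = λ x _ full → full x }

into-indiscrete-continuous : (S : NbhdSpace) (X : Set) (x₀ : X)
  (f : NbhdSpace.Carrier S → X) → Continuous S (indiscrete X x₀) f
into-indiscrete-continuous S X x₀ f x N full =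
  up-closed (λ _ → Unit) _ (λ y _ → full (f y)) has-full
  where open IsFilter (NbhdSpace.filter S x)

indiscrete-closure : {ℓ : Level} (X : Set) (x₀ : X) (A : X → Set ℓ) (x : X) →
  𝒞 (indiscrete X x₀) A x ⇔ ∃ A
indiscrete-closure X x₀ A x = mk⇔
  (λ cl → let (y , Ay , _) = whole-space-meets-A cl in y , Ay)
  (λ { (y , Ay) N full → y , Ay , full y })
  where
    whole-space-meets-A : 𝒞 (indiscrete X x₀) A x → ∃ λ y → A y × Unit
    whole-space-meets-A cl = cl (λ _ → Unit) (λ _ → tt)

-- An indiscrete space with two distinct points is not T₀: each lies in
-- the closure of the other.
indiscrete-not-T₀ : (X : Set) (x₀ x y : X) → ¬ x ≡ y → ¬ T₀ (indiscrete X x₀)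
indiscrete-not-T₀ X x₀ x y x≢y t₀ = x≢y (t₀ x y (inSingleton x y) (inSingleton y x))
  where
    inSingleton : (a b : X) → 𝒞 (indiscrete X x₀) (λ z → z ≡ a) b
    inSingleton a b = Equivalence.from (indiscrete-closure X x₀ _ b) (a , refl)

-- The one-point index space.  It is connected because a non-empty part of
-- a one-point space is dense, hence meets every other non-empty part's closure.
point-index : IndexSpace
point-index = record
  { space     = indiscrete Unit tt
  ; connected = λ { (U , V , _ , (tt , u) , (tt , v) , (sep , _)) →
      sep tt (Equivalence.from (indiscrete-closure Unit tt U tt) (tt , u) , v) }
  ; _≤_       = λ _ _ → Unit
  ; ≤-refl    = λ _ → tt
  ; ≤-trans   = λ _ _ _ _ _ → tt
  ; ≤-antisym = λ _ _ _ _ → refl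
  ; ≤-total   = λ _ _ → inj₁ tt
  ; 0ᵢ        = tt
  ; 0-least   = λ _ → tt }

indiscrete-model : {P : Set} (X : Set) → X → IndexSpace → (P → Set) → NbhdModel P
indiscrete-model X x₀ ℐ W = record
  { space = indiscrete X x₀ ; index = ℐ ; V = λ _ → W }

module Uniform {P : Set} (W : P → Set) where

  -- The truth value every point of an indiscrete model with valuation W
  -- gives to a formula.  𝓝 is decided by inhabitation, and both reachability
  -- operators reduce to their target formula (witnessed by constant paths).
  ⟦_⟧ : Formula P → Set
  ⟦ atom a ⟧  = W a
  ⟦ ⊤ᶠ ⟧      = Unit
  ⟦ ¬ᶠ φ ⟧    = ¬ ⟦ φ ⟧
  ⟦ φ ∧ᶠ ψ ⟧  = ⟦ φ ⟧ × ⟦ ψ ⟧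
  ⟦ 𝓝 φ ⟧     = ⟦ φ ⟧
  ⟦ φ 𝓡 ψ ⟧   = ⟦ ψ ⟧
  ⟦ φ 𝓟 ψ ⟧   = ⟦ ψ ⟧

  module _ (X : Set) (x₀ : X) (ℐ : IndexSpace) where
    open Sem (indiscrete-model X x₀ ℐ W)
    open IndexSpace ℐ using (I; 0ᵢ; _≤_; _<_; ≤-antisym; 0-least)

    constant-path : X → NbhdModel.Path (indiscrete-model X x₀ ℐ W)
    constant-path x = (λ _ → x) , into-indiscrete-continuous (IndexSpace.space ℐ) X x₀ (λ _ → x)

    -- No index lies strictly between 0 and 0: the side conditions of the
    -- reachability operators are vacuous for paths of length 0.
    nothing-below-0 : ∀ i → i < 0ᵢ → ⊥
    nothing-below-0 i (i≤0 , i≢0) = i≢0 (≤-antisym i 0ᵢ i≤0 (0-least i))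

    nothing-between-0-0 : ∀ i → 0ᵢ < i → i ≤ 0ᵢ → ⊥
    nothing-between-0-0 i (0≤i , 0≢i) i≤0 = 0≢i (≤-antisym 0ᵢ i 0≤i i≤0)

    uniform-truth : ∀ φ x → (x ⊨ φ) ⇔ ⟦ φ ⟧
    uniform-truth (atom a) x = mk⇔ lower lift
    uniform-truth ⊤ᶠ x = mk⇔ (λ _ → tt) (λ _ → lift tt)
    uniform-truth (¬ᶠ φ) x = mk⇔
      (λ ¬x⊨φ ⟦φ⟧ → ¬x⊨φ (Equivalence.from (uniform-truth φ x) ⟦φ⟧))
      (λ ¬⟦φ⟧ x⊨φ → ¬⟦φ⟧ (Equivalence.to (uniform-truth φ x) x⊨φ))
    uniform-truth (φ ∧ᶠ ψ) x = mk⇔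
      (λ { (x⊨φ , x⊨ψ) → Equivalence.to (uniform-truth φ x) x⊨φ
                       , Equivalence.to (uniform-truth ψ x) x⊨ψ })
      (λ { (⟦φ⟧ , ⟦ψ⟧) → Equivalence.from (uniform-truth φ x) ⟦φ⟧
                       , Equivalence.from (uniform-truth ψ x) ⟦ψ⟧ })
    uniform-truth (𝓝 φ) x = mk⇔
      (λ cl → let (y , y⊨φ) = Equivalence.to (indiscrete-closure X x₀ _ x) cl
              in Equivalence.to (uniform-truth φ y) y⊨φ)
      (λ ⟦φ⟧ → Equivalence.from (indiscrete-closure X x₀ _ x)
                 (x , Equivalence.from (uniform-truth φ x) ⟦φ⟧))
    uniform-truth (φ 𝓡 ψ) x = mk⇔
      (λ { ((p , _) , _ , _ , p0⊨ψ , _) → Equivalence.to (uniform-truth ψ (p 0ᵢ)) p0⊨ψ })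
      (λ ⟦ψ⟧ → constant-path x , 0ᵢ , refl , Equivalence.from (uniform-truth ψ x) ⟦ψ⟧
             , λ i 0<i i≤0 → ⊥-elim (nothing-between-0-0 i 0<i i≤0))
    uniform-truth (φ 𝓟 ψ) x = mk⇔
      (λ { ((p , _) , _ , n , pn⊨ψ , _) → Equivalence.to (uniform-truth ψ (p n)) pn⊨ψ })
      (λ ⟦ψ⟧ → constant-path x , refl , 0ᵢ , Equivalence.from (uniform-truth ψ x) ⟦ψ⟧
             , λ i _ i<0 → ⊥-elim (nothing-below-0 i i<0))

proposition19 : (P : Set) →
    ¬ (Σ (Formula P) λ φ →
         (M : NbhdModel P) →
           T₀ (NbhdModel.space M) ⇔ (∀ x → Sem._⊨_ M x φ))
proposition19 P (φ , defines-T₀) =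
  indiscrete-not-T₀ Bool true true false (λ ())
    (Equivalence.from (defines-T₀ two-points)
      (λ b → Equivalence.from (uniform-truth Bool true point-index φ b) ⟦φ⟧))
  where
    open Uniform {P} (λ _ → ⊥)
    one-point two-points : NbhdModel P
    one-point  = indiscrete-model Unit tt point-index (λ _ → ⊥)
    two-points = indiscrete-model Bool true point-index (λ _ → ⊥)

    one-point-T₀ : T₀ (NbhdModel.space one-point)
    one-point-T₀ tt tt _ _ = refl

    ⟦φ⟧ : ⟦ φ ⟧
    ⟦φ⟧ = Equivalence.to (uniform-truth Unit tt point-index φ tt)
            (Equivalence.to (defines-T₀ one-point) one-point-T₀ tt)
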